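{- Let $p$ be a prime, $\alpha\ge3$ an integer, and $M_{p^\alpha}=\langle a,b\mid a^{p^{\alpha-1}}=b^p=1,\ bab^{ -1}=a^{1+p^{\alpha-2}}\rangle$ the modular group of order $p^\alpha$. Then (i) $\Gamma_N(M_{p^\alpha})\cong 2K_2$ if $p^\alpha=8$, and $\Gamma_N(M_{p^\alpha})\cong K_p$ otherwise; (ii) $\Gamma(M_{p^\alpha})\cong K_4+2K_2$ if $p^\alpha=8$, and $\Gamma(M_{p^\alpha})\cong K_{(\alpha-1)(p+1)}$ otherwise.
   Context: For a group $G$, $\Gamma(G)$ is the simple graph whose vertices are the subgroups of $G$ other than $\{1\}$ and $G$, and $\Gamma_N(G)$ is the simple graph whose vertices are the proper non-normal subgroups of $G$; in both, two distinct vertices $H,K$ are adjacent iff $HK=KH$. $K_m$ is the complete graph on $m$ vertices, $2K_2$ the disjoint union of two copies of $K_2$, and $G_1+G_2$ the join (disjoint union plus all edges between $G_1$ and $G_2$). -}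

module Defs where

open import Data.Nat using (ℕ; zero; suc; _+_; _*_; _∸_; _^_; NonZero)
open import Data.Nat.Properties using (m^n≢0)
open import Data.Nat.DivMod using (_mod_)
open import Data.Nat.Primality using (Prime; prime⇒nonZero)
open import Data.Fin using (Fin; toℕ; splitAt)
open import Data.Vec using (Vec; lookup)
open import Data.Bool using (Bool; true)
open import Data.Product using (Σ; ∃; ∃₂; _×_; _,_)
open import Data.Sum using (_⊎_; inj₁; inj₂)
open import Data.Empty using (⊥)
open import Data.Unit using (⊤)
open import Relation.Nullary using (¬_)
open import Relation.Binary.PropositionalEquality using (_≡_; _≢_)
open import Function.Bundles using (_⇔_)

-- Finite simple graphs on vertex set Fin n (adjacency only consulted
-- for distinct vertices), complete graphs, disjoint union, join.

record FinGraph : Set₁ where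
  field
    size : ℕ
    Adj  : Fin size → Fin size → Set
open FinGraph public

K : ℕ → FinGraph
K k = record { size = k ; Adj = λ i j → i ≢ j }

_⊕_ : FinGraph → FinGraph → FinGraph
G₁ ⊕ G₂ = record { size = size G₁ + size G₂ ; Adj = adj }
  where
  adj : Fin (size G₁ + size G₂) → Fin (size G₁ + size G₂) → Set
  adj i j with splitAt (size G₁) i | splitAt (size G₁) j
  ... | inj₁ a | inj₁ b = Adj G₁ a b
  ... | inj₂ a | inj₂ b = Adj G₂ a b
  ... | inj₁ _ | inj₂ _ = ⊥
  ... | inj₂ _ | inj₁ _ = ⊥

_+ᴶ_ : FinGraph → FinGraph → FinGraph
G₁ +ᴶ G₂ = record { size = size G₁ + size G₂ ; Adj = adj }
  where
  adj : Fin (size G₁ + size G₂) → Fin (size G₁ + size G₂) → Set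
  adj i j with splitAt (size G₁) i | splitAt (size G₁) j
  ... | inj₁ a | inj₁ b = Adj G₁ a b
  ... | inj₂ a | inj₂ b = Adj G₂ a b
  ... | inj₁ _ | inj₂ _ = ⊤
  ... | inj₂ _ | inj₁ _ = ⊤

-- The modular group M_{p^α} = ⟨a,b | a^{p^{α-1}} = b^p = 1, bab⁻¹ = a^{1+p^{α-2}}⟩,
-- realised concretely: the element a^i b^j (0 ≤ i < p^{α-1}, 0 ≤ j < p)
-- is the pair (i , j), with
--   (a^i b^j)(a^k b^l) = a^{i + k r^j} b^{j+l},   r = 1 + p^{α-2}.

module Modular (p α : ℕ) (pr : Prime p) where

  instance
    nzp : NonZero p
    nzp = prime⇒nonZero pr

  m : ℕ
  m = p ^ (α ∸ 1)

  instance
    nzm : NonZero m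
    nzm = m^n≢0 p (α ∸ 1)

  r : ℕ
  r = 1 + p ^ (α ∸ 2)

  El : Set
  El = Fin m × Fin p

  _·_ : El → El → El
  (i , j) · (k , l) = ((toℕ i + toℕ k * r ^ toℕ j) mod m , (toℕ j + toℕ l) mod p)

  e : El
  e = (0 mod m , 0 mod p)

  -- subsets of the group, as boolean tables (decidable, extensional equality)
  Sub : Set
  Sub = Vec (Vec Bool p) m

  _∈_ : El → Sub → Set
  (i , j) ∈ S = lookup (lookup S i) j ≡ true

  record IsSubgroup (H : Sub) : Set where
    field
      e∈      : e ∈ H
      ·-closed : ∀ x y → x ∈ H → y ∈ H → (x · y) ∈ H
      inv-closed : ∀ x → x ∈ H → ∃ λ y → y ∈ H × (x · y ≡ e)

  IsTrivial : Sub → Set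
  IsTrivial H = ∀ x → (x ∈ H) ⇔ (x ≡ e)

  IsWhole : Sub → Set
  IsWhole H = ∀ x → x ∈ H

  IsNormal : Sub → Set
  IsNormal H = ∀ g g' h → g · g' ≡ e → h ∈ H → ((g · h) · g') ∈ H

  Permutable : Sub → Sub → Set
  Permutable H K′ = ∀ x →
    (∃₂ λ h k → h ∈ H × k ∈ K′ × x ≡ h · k) ⇔ (∃₂ λ k h → k ∈ K′ × h ∈ H × x ≡ k · h)

  VertΓ : Sub → Set
  VertΓ H = IsSubgroup H × ¬ IsTrivial H × ¬ IsWhole H

  VertΓN : Sub → Set
  VertΓN H = IsSubgroup H × ¬ IsWhole H × ¬ IsNormal H

  IsoTo : (Sub → Set) → FinGraph → Set
  IsoTo Vert T =
    Σ (Fin (size T) → Sub) λ f →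
      (∀ i → Vert (f i)) ×
      (∀ i j → f i ≡ f j → i ≡ j) ×
      (∀ H → Vert H → ∃ λ i → f i ≡ H) ×
      (∀ i j → i ≢ j → (Permutable (f i) (f j) ⇔ Adj T i j))

Γ≅ : (p α : ℕ) → Prime p → FinGraph → Set
Γ≅ p α pr T = Modular.IsoTo p α pr (Modular.VertΓ p α pr) T

ΓN≅ : (p α : ℕ) → Prime p → FinGraph → Set
ΓN≅ p α pr T = Modular.IsoTo p α pr (Modular.VertΓN p α pr) T

{-# OPTIONS --safe #-}
module Submission where

-- Write α = 3 + t, m = p^(α−1) and q = p^(α−2), so that b a b⁻¹ = a^(1+q) and q² ≡ 0 (mod m).
-- Then a^x b^j · a^y b^l = a^(x + y + j y q) b^(j+l), and every commutator is a power of a^q.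
-- Hence every subgroup containing a^q is normal, and normal subgroups permute with all
-- subgroups.  A subgroup H is determined by the least k with a^(p^k) ∈ H together with one
-- element a^y b ∈ H, if there is one: either H = A k = ⟨a^(p^k)⟩ or H = {a^x b^j | x ≡ j y (mod p^k)}.
-- Since (a^y b)^p = a^(p y u) with u = 1 + p^t p(p−1)/2, we get p^(k−1) ∣ y whenever p ∤ u,
-- which holds exactly when p^α ≠ 8; then H = B (k−1) c = ⟨a^(p^k), a^(c p^(k−1)) b⟩ with c < p.
-- So Γ has the (α−1)(p+1) vertices A k and B k c (k ≤ α−2, c < p).  All of them contain a^q
-- except the p subgroups B (α−2) c of order p, which commute elementwise; so Γ is complete and
-- these p subgroups are exactly the non-normal ones.  For p^α = 8 the group is D₈, whose
-- subgroup lattice is checked by exhaustive search.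

open import Level using (0ℓ)
open import Data.Bool using (Bool; true; false)
import Data.Bool.Properties as Boolₚ
open import Data.Empty using (⊥-elim)
open import Data.Fin using (Fin; zero; toℕ; fromℕ; fromℕ<; inject; splitAt; join; remQuot; combine)
import Data.Fin.Properties as Finₚ
open import Data.Nat
open import Data.Nat.Coprimality using (Coprime; coprime-divisor; coprime⇒gcd≡1)
open import Data.Nat.Divisibility
open import Data.Nat.DivMod hiding (_mod_)
open import Data.Nat.GCD using (gcd; gcd-GCD; gcd[m,n]∣m; gcd[m,n]∣n; module Bézout)
open import Data.Nat.Primality
  using (Prime; euclidsLemma; prime⇒irreducible; prime⇒nonZero; prime⇒nonTrivial)
open import Data.Nat.Properties
open import Data.Nat.Tactic.RingSolver using (solve-∀)
open import Data.Product using (∃; ∃₂; _×_; _,_; proj₁; proj₂; map₂; uncurry)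
import Data.Product.Properties as Productₚ
open import Data.Sum using (_⊎_; inj₁; inj₂)
open import Data.Unit using (tt)
open import Data.Vec using (Vec; []; _∷_; tabulate; lookup)
import Data.Vec.Properties as Vecₚ
open import Data.Vec.Relation.Binary.Pointwise.Extensional using (ext; Pointwise-≡⇒≡)
open import Function using (_∘_)
open import Function.Bundles using (_⇔_; mk⇔; Equivalence)
open import Function.Construct.Symmetry using (⇔-sym)
open import Function.Properties.Equivalence using () renaming (trans to ⇔-trans)
open import Relation.Binary.Bundles using (Setoid)
open import Relation.Binary.PropositionalEquality
import Relation.Binary.Reasoning.Setoid as SetoidReasoning
open import Relation.Binary.Structures using (IsEquivalence)
open import Relation.Nullary using (¬_)
open import Relation.Nullary.Decidable
  using (Dec; yes; no; does; map′; ¬?; _×-dec_; _→-dec_; decidable-stable; from-yes; from-no)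
open import Relation.Unary using (Pred; Decidable)

open import Defs

-- Congruences

infix 4 _≡_mod_ _≡?_mod_

record _≡_mod_ (a b n : ℕ) .{{_ : NonZero n}} : Set where
  constructor mk-mod
  field %-≡ : a % n ≡ b % n
open _≡_mod_

module _ {n : ℕ} .{{_ : NonZero n}} where

  ≡-mod-isEquivalence : IsEquivalence (λ a b → a ≡ b mod n)
  ≡-mod-isEquivalence = record
    { refl  = mk-mod refl
    ; sym   = λ (mk-mod e) → mk-mod (sym e)
    ; trans = λ (mk-mod e) (mk-mod f) → mk-mod (trans e f)
    }

  open IsEquivalence ≡-mod-isEquivalence public
    renaming (refl to ≡-mod-refl; sym to ≡-mod-sym; trans to ≡-mod-trans)

  ≡-mod-setoid : Setoid _ _
  ≡-mod-setoid = record { isEquivalence = ≡-mod-isEquivalence }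

  module ≡-mod-Reasoning = SetoidReasoning ≡-mod-setoid

  ≡⇒≡-mod : ∀ {a b} → a ≡ b → a ≡ b mod n
  ≡⇒≡-mod refl = ≡-mod-refl

  +-cong-mod : ∀ {a b c d} → a ≡ b mod n → c ≡ d mod n → a + c ≡ b + d mod n
  +-cong-mod {a} {b} {c} {d} (mk-mod e) (mk-mod f) = mk-mod (begin
    (a + c) % n             ≡⟨ %-distribˡ-+ a c n ⟩
    (a % n + c % n) % n     ≡⟨ cong₂ (λ x y → (x + y) % n) e f ⟩
    (b % n + d % n) % n     ≡⟨ %-distribˡ-+ b d n ⟨
    (b + d) % n             ∎)
    where open ≡-Reasoning

  *-cong-mod : ∀ {a b c d} → a ≡ b mod n → c ≡ d mod n → a * c ≡ b * d mod n
  *-cong-mod {a} {b} {c} {d} (mk-mod e) (mk-mod f) = mk-mod (begin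
    (a * c) % n             ≡⟨ %-distribˡ-* a c n ⟩
    (a % n * (c % n)) % n   ≡⟨ cong₂ (λ x y → (x * y) % n) e f ⟩
    (b % n * (d % n)) % n   ≡⟨ %-distribˡ-* b d n ⟨
    (b * d) % n             ∎)
    where open ≡-Reasoning

  %-≡-mod : ∀ a → a % n ≡ a mod n
  %-≡-mod a = mk-mod (m%n%n≡m%n a n)

  +-*-≡-mod : ∀ a k → a + k * n ≡ a mod n
  +-*-≡-mod a k = mk-mod ([m+kn]%n≡m%n a k n)

  ≡[m+kn]⇒≡-mod : ∀ {a b} k → a ≡ b + k * n → a ≡ b mod n
  ≡[m+kn]⇒≡-mod {b = b} k refl = +-*-≡-mod b k

  ∣⇒≡0-mod : ∀ {a} → n ∣ a → a ≡ 0 mod n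
  ∣⇒≡0-mod {a} n∣a = mk-mod (trans (n∣m⇒m%n≡0 a n n∣a) (sym (m*n%n≡0 0 n)))

  ≡0-mod⇒∣ : ∀ {a} → a ≡ 0 mod n → n ∣ a
  ≡0-mod⇒∣ {a} (mk-mod e) = m%n≡0⇒n∣m a n (trans e (m*n%n≡0 0 n))

  -- pred n * a stands in for − a, so that no truncated subtraction is needed
  +-inverse-mod : ∀ a → a + pred n * a ≡ 0 mod n
  +-inverse-mod a = ∣⇒≡0-mod (divides a (begin
    a + pred n * a    ≡⟨⟩
    suc (pred n) * a  ≡⟨ cong (_* a) (suc-pred n) ⟩
    n * a             ≡⟨ *-comm n a ⟩
    a * n             ∎))
    where open ≡-Reasoning

  +-cancelʳ-mod : ∀ {a b} c → a + c ≡ b + c mod n → a ≡ b mod n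
  +-cancelʳ-mod {a} {b} c a+c≡b+c = begin
    a                      ≡⟨ +-identityʳ a ⟨
    a + 0                  ≈⟨ +-cong-mod ≡-mod-refl (+-inverse-mod c) ⟨
    a + (c + pred n * c)   ≡⟨ +-assoc a c _ ⟨
    a + c + pred n * c     ≈⟨ +-cong-mod a+c≡b+c ≡-mod-refl ⟩
    b + c + pred n * c     ≡⟨ +-assoc b c _ ⟩
    b + (c + pred n * c)   ≈⟨ +-cong-mod ≡-mod-refl (+-inverse-mod c) ⟩
    b + 0                  ≡⟨ +-identityʳ b ⟩
    b                      ∎
    where open ≡-mod-Reasoning

  ≡-mod⇒≡ : ∀ {a b} → a < n → b < n → a ≡ b mod n → a ≡ b
  ≡-mod⇒≡ a<n b<n (mk-mod e) = trans (sym (m<n⇒m%n≡m a<n)) (trans e (m<n⇒m%n≡m b<n))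

_≡?_mod_ : ∀ a b n .{{_ : NonZero n}} → Dec (a ≡ b mod n)
a ≡? b mod n = map′ mk-mod %-≡ (a % n ≟ b % n)

≡-mod-1 : ∀ a b → a ≡ b mod 1
≡-mod-1 a b = mk-mod (trans (n%1≡0 a) (sym (n%1≡0 b)))

≡-mod-∣ : ∀ {d n a b} .{{_ : NonZero d}} .{{_ : NonZero n}} → d ∣ n → a ≡ b mod n → a ≡ b mod d
≡-mod-∣ {d} {n} {a} {b} d∣n (mk-mod e) = mk-mod (begin
  a % d       ≡⟨ m∣n⇒o%n%m≡o%m d n a d∣n ⟨
  a % n % d   ≡⟨ cong (_% d) e ⟩
  b % n % d   ≡⟨ m∣n⇒o%n%m≡o%m d n b d∣n ⟩
  b % d       ∎)
  where open ≡-Reasoning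

*-≡-mod : ∀ {n} k {a b} .{{_ : NonZero n}} .{{_ : NonZero (n * k)}} →
          a ≡ b mod n → a * k ≡ b * k mod n * k
*-≡-mod {n} k {a} {b} (mk-mod e) = mk-mod (begin
  a * k % (n * k)   ≡⟨ m%n*o≡m*o%[n*o] a n k ⟨
  a % n * k         ≡⟨ cong (_* k) e ⟩
  b % n * k         ≡⟨ m%n*o≡m*o%[n*o] b n k ⟩
  b * k % (n * k)   ∎)
  where open ≡-Reasoning

bézout-mod : ∀ a n .{{_ : NonZero n}} → ∃ λ s → s * a ≡ gcd a n mod n
bézout-mod a n with Bézout.identity (gcd-GCD a n)
... | Bézout.+- x y eq = x , ≡[m+kn]⇒≡-mod y (sym eq)
... | Bézout.-+ x y eq = pred n * x , ≡-mod-sym (begin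
  d                                  ≡⟨ +-identityʳ d ⟨
  d + 0                              ≈⟨ +-cong-mod ≡-mod-refl (+-inverse-mod (x * a)) ⟨
  d + (x * a + pred n * (x * a))     ≡⟨ +-assoc d (x * a) _ ⟨
  d + x * a + pred n * (x * a)       ≡⟨ cong (_+ pred n * (x * a)) eq ⟩
  y * n + pred n * (x * a)           ≡⟨ +-comm (y * n) _ ⟩
  pred n * (x * a) + y * n           ≈⟨ +-*-≡-mod _ y ⟩
  pred n * (x * a)                   ≡⟨ *-assoc (pred n) x a ⟨
  pred n * x * a                     ∎)
  where
  d = gcd a n
  open ≡-mod-Reasoning

-- Prime powers and triangular numbers

^-monoʳ-∣ : ∀ p {k l} → k ≤ l → p ^ k ∣ p ^ l
^-monoʳ-∣ p {k} k≤l with m≤n⇒∃[o]m+o≡n k≤l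
... | o , refl = divides (p ^ o) (trans (^-distribˡ-+-* p k o) (*-comm (p ^ k) (p ^ o)))

^-cancelʳ-∣ : ∀ {p} → 1 < p → ∀ {k l} → p ^ k ∣ p ^ l → k ≤ l
^-cancelʳ-∣ {p} 1<p {k} {l} p^k∣p^l = ≮⇒≥ λ l<k →
  <⇒≱ (^-monoʳ-< p 1<p l<k) (∣⇒≤ {{m^n≢0 p l {{>-nonZero (<-trans z<s 1<p)}}}} p^k∣p^l)

module _ {p : ℕ} (pr : Prime p) where
  private instance
    p≢0 : NonZero p
    p≢0 = prime⇒nonZero pr

  prime>1 : 1 < p
  prime>1 = nonTrivial⇒n>1 p {{prime⇒nonTrivial pr}}

  prime∤1 : ¬ p ∣ 1
  prime∤1 p∣1 = <⇒≢ prime>1 (sym (∣1⇒≡1 p∣1))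

  ∤⇒coprime : ∀ {d} → ¬ p ∣ d → Coprime d p
  ∤⇒coprime p∤d (i∣d , i∣p) with prime⇒irreducible pr i∣p
  ... | inj₁ i≡1  = i≡1
  ... | inj₂ refl = ⊥-elim (p∤d i∣d)

  ∣p^n⇒≡p^v : ∀ {d} n → d ∣ p ^ n → ∃ λ v → v ≤ n × d ≡ p ^ v
  ∣p^n⇒≡p^v zero d∣1 = 0 , z≤n , ∣1⇒≡1 d∣1
  ∣p^n⇒≡p^v {d} (suc n) d∣p^[1+n] with p ∣? d
  ... | yes (divides d′ refl) =
    let d′∣p^n = *-cancelʳ-∣ p (subst (d′ * p ∣_) (*-comm p (p ^ n)) d∣p^[1+n])
        v , v≤n , d′≡p^v = ∣p^n⇒≡p^v {d′} n d′∣p^n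
    in suc v , s≤s v≤n , trans (cong (_* p) d′≡p^v) (*-comm (p ^ v) p)
  ... | no p∤d =
    let v , v≤n , d≡p^v = ∣p^n⇒≡p^v n (coprime-divisor (∤⇒coprime p∤d) d∣p^[1+n])
    in v , m≤n⇒m≤1+n v≤n , d≡p^v

  ∤⇒coprime-^ : ∀ {u} k → ¬ p ∣ u → Coprime (p ^ k) u
  ∤⇒coprime-^ k p∤u (i∣p^k , i∣u) with ∣p^n⇒≡p^v k i∣p^k
  ... | zero  , _ , i≡1 = i≡1
  ... | suc v , _ , refl = ⊥-elim (p∤u (∣-trans (m∣m*n (p ^ v)) i∣u))

tri : ℕ → ℕ
tri zero    = 0
tri (suc n) = tri n + n

2*tri+n≡n*n : ∀ n → 2 * tri n + n ≡ n * n
2*tri+n≡n*n zero    = refl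
2*tri+n≡n*n (suc n) = begin
  2 * (tri n + n) + suc n        ≡⟨ regroup (tri n) n ⟩
  (2 * tri n + n) + (2 * n + 1)  ≡⟨ cong (_+ (2 * n + 1)) (2*tri+n≡n*n n) ⟩
  n * n + (2 * n + 1)            ≡⟨ square n ⟩
  suc n * suc n                  ∎
  where
  open ≡-Reasoning
  regroup : ∀ T n → 2 * (T + n) + suc n ≡ (2 * T + n) + (2 * n + 1)
  regroup = solve-∀
  square : ∀ n → n * n + (2 * n + 1) ≡ suc n * suc n
  square = solve-∀

n∣2*tri[n] : ∀ n → n ∣ 2 * tri n
n∣2*tri[n] n = ∣m+n∣m⇒∣n (subst (n ∣_) (trans (sym (2*tri+n≡n*n n)) (+-comm (2 * tri n) n)) (m∣m*n n)) ∣-refl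

n∣tri[n+n] : ∀ n → n ∣ tri (n + n)
n∣tri[n+n] n = ∣m+n∣m⇒∣n (divides (n + n) (*-cancelˡ-≡ _ _ 2 (begin
  2 * (n + tri (n + n))       ≡⟨ regroup (tri (n + n)) n ⟩
  2 * tri (n + n) + (n + n)   ≡⟨ 2*tri+n≡n*n (n + n) ⟩
  (n + n) * (n + n)           ≡⟨ double n ⟩
  2 * ((n + n) * n)           ∎))) ∣-refl
  where
  open ≡-Reasoning
  regroup : ∀ T n → 2 * (n + T) ≡ 2 * T + (n + n)
  regroup = solve-∀
  double : ∀ n → (n + n) * (n + n) ≡ 2 * ((n + n) * n)
  double = solve-∀

odd-prime∣tri : ∀ {p} → Prime p → p ≢ 2 → p ∣ tri p
odd-prime∣tri {p} pr p≢2 with euclidsLemma 2 (tri p) pr (n∣2*tri[n] p)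
... | inj₁ p∣2   = ⊥-elim (p≢2 (≤-antisym (∣⇒≤ p∣2) (prime>1 pr)))
... | inj₂ p∣tri = p∣tri

prime∣tri·p^t : ∀ {p} t → Prime p → p ^ (3 + t) ≢ 8 → p ∣ tri p * p ^ t
prime∣tri·p^t {p} t pr p^α≢8 with p ≟ 2
... | no p≢2 = ∣m⇒∣m*n (p ^ t) (odd-prime∣tri pr p≢2)
prime∣tri·p^t zero    pr p^α≢8 | yes refl = ⊥-elim (p^α≢8 refl)
prime∣tri·p^t (suc t) pr p^α≢8 | yes refl = ∣n⇒∣m*n (tri 2) (m∣m*n (2 ^ t))

-- (a^y b)^p = a^(p y u) with u = 1 + tri p · p^t; this is the one place where p^α ≢ 8 is used
prime∤1+tri·p^t : ∀ {p} t → Prime p → p ^ (3 + t) ≢ 8 → ¬ p ∣ 1 + tri p * p ^ t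
prime∤1+tri·p^t {p} t pr p^α≢8 p∣u =
  prime∤1 pr (∣m+n∣m⇒∣n (subst (p ∣_) (+-comm 1 (tri p * p ^ t)) p∣u) (prime∣tri·p^t t pr p^α≢8))

p^[3+t]≡8⇒p≡2∧t≡0 : ∀ {p} t → Prime p → p ^ (3 + t) ≡ 8 → p ≡ 2 × t ≡ 0
p^[3+t]≡8⇒p≡2∧t≡0 {p} t pr p^α≡8 = p≡2 , t≡0 t (subst (λ p → p ^ (3 + t) ≡ 8) p≡2 p^α≡8)
  where
  p^3≤8 : p ^ 3 ≤ 8
  p^3≤8 = subst (p ^ 3 ≤_) p^α≡8 (^-monoʳ-≤ p {{prime⇒nonZero pr}} (m≤m+n 3 t))
  p≡2 : p ≡ 2
  p≡2 = ≤-antisym (≮⇒≥ λ 2<p → from-no (27 ≤? 8) (≤-trans (^-monoˡ-≤ 3 2<p) p^3≤8)) (prime>1 pr)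
  t≡0 : ∀ t → 2 ^ (3 + t) ≡ 8 → t ≡ 0
  t≡0 zero    _     = refl
  t≡0 (suc t) 2^α≡8 = ⊥-elim (from-no (16 ≤? 8) (subst (16 ≤_) 2^α≡8 (^-monoʳ-≤ 2 (m≤m+n 4 t))))

-- Decidability

minimal-witness : ∀ {P : Pred ℕ 0ℓ} → Decidable P → ∀ {n} → P n →
                  ∃ λ k → k ≤ n × P k × (∀ {v} → v < k → ¬ P v)
minimal-witness {P} P? {n} Pn
  with Finₚ.¬∀⟶∃¬-smallest (suc n) (λ i → ¬ P (toℕ i)) (λ i → ¬? (P? (toℕ i)))
         (λ ¬P → ¬P (fromℕ n) (subst P (sym (Finₚ.toℕ-fromℕ n)) Pn))
... | k , ¬¬Pk , below = toℕ k , s≤s⁻¹ (Finₚ.toℕ<n k) , decidable-stable (P? (toℕ k)) ¬¬Pk , λ v<k →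
  subst (¬_ ∘ P) (trans (Finₚ.toℕ-inject (fromℕ< v<k)) (Finₚ.toℕ-fromℕ< v<k)) (below (fromℕ< v<k))

does≡true⇔ : ∀ {A : Set} (A? : Dec A) → does A? ≡ true ⇔ A
does≡true⇔ (yes a)  = mk⇔ (λ _ → a) (λ _ → refl)
does≡true⇔ (no ¬a) = mk⇔ (λ ()) (λ a → ⊥-elim (¬a a))

_⇔?_ : ∀ {A B : Set} → Dec A → Dec B → Dec (A ⇔ B)
A? ⇔? B? = map′ (uncurry mk⇔) (λ A⇔B → Equivalence.to A⇔B , Equivalence.from A⇔B)
  ((A? →-dec B?) ×-dec (B? →-dec A?))

Searchable : Set → Set₁
Searchable A = ∀ {P : Pred A 0ℓ} → Decidable P → Dec (∀ x → P x)

∀-Bool? : Searchable Bool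
∀-Bool? P? = map′ (λ (Pt , Pf) → λ { true → Pt ; false → Pf }) (λ ∀P → ∀P true , ∀P false)
  (P? true ×-dec P? false)

∀-Vec? : ∀ {A} → Searchable A → ∀ n → Searchable (Vec A n)
∀-Vec? ∀? zero    P? = map′ (λ { P[] [] → P[] }) (λ ∀P → ∀P []) (P? [])
∀-Vec? ∀? (suc n) P? = map′ (λ ∀P → λ { (x ∷ xs) → ∀P x xs }) (λ ∀P x xs → ∀P (x ∷ xs))
  (∀? λ x → ∀-Vec? ∀? n λ xs → P? (x ∷ xs))

AdjDecidable : FinGraph → Set
AdjDecidable T = ∀ i j → Dec (Adj T i j)

K-adj? : ∀ n → AdjDecidable (K n)
K-adj? n i j = ¬? (i Finₚ.≟ j)

⊕-adj? : ∀ {G₁ G₂} → AdjDecidable G₁ → AdjDecidable G₂ → AdjDecidable (G₁ ⊕ G₂)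
⊕-adj? {G₁} adj₁? adj₂? i j with splitAt (size G₁) i | splitAt (size G₁) j
... | inj₁ a | inj₁ b = adj₁? a b
... | inj₂ a | inj₂ b = adj₂? a b
... | inj₁ _ | inj₂ _ = no λ ()
... | inj₂ _ | inj₁ _ = no λ ()

+ᴶ-adj? : ∀ {G₁ G₂} → AdjDecidable G₁ → AdjDecidable G₂ → AdjDecidable (G₁ +ᴶ G₂)
+ᴶ-adj? {G₁} adj₁? adj₂? i j with splitAt (size G₁) i | splitAt (size G₁) j
... | inj₁ a | inj₁ b = adj₁? a b
... | inj₂ a | inj₂ b = adj₂? a b
... | inj₁ _ | inj₂ _ = yes tt
... | inj₂ _ | inj₁ _ = yes tt

-- The modular group

module ModularGroup (p t : ℕ) (pr : Prime p) where
  open Modular p (3 + t) pr public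

  -- here α = 3 + t, and m = p * q and r = 1 + q hold by definition
  q : ℕ
  q = p ^ (1 + t)

  instance
    q≢0 : NonZero q
    q≢0 = m^n≢0 p (1 + t)

  -- ⟨ x , j ⟩ is a^x b^j, for exponents that need not be reduced
  ⟨_,_⟩ : ℕ → ℕ → El
  ⟨ x , j ⟩ = x mod m , j mod p
    where open import Data.Nat.DivMod using (_mod_)

  private
    toℕ-mod : ∀ a n .{{_ : NonZero n}} → toℕ (fromℕ< (m%n<n a n)) ≡ a % n
    toℕ-mod a n = Finₚ.toℕ-fromℕ< (m%n<n a n)

  ⟨⟩-cong : ∀ {x x′ j j′} → x ≡ x′ mod m → j ≡ j′ mod p → ⟨ x , j ⟩ ≡ ⟨ x′ , j′ ⟩
  ⟨⟩-cong (mk-mod e) (mk-mod f) = cong₂ _,_ (Finₚ.fromℕ<-cong _ _ e _ _) (Finₚ.fromℕ<-cong _ _ f _ _)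

  ⟨⟩-injective : ∀ {x x′ j j′} → ⟨ x , j ⟩ ≡ ⟨ x′ , j′ ⟩ → x ≡ x′ mod m × j ≡ j′ mod p
  ⟨⟩-injective {x} {x′} {j} {j′} e =
    mk-mod (trans (sym (toℕ-mod x m)) (trans (cong (toℕ ∘ proj₁) e) (toℕ-mod x′ m))) ,
    mk-mod (trans (sym (toℕ-mod j p)) (trans (cong (toℕ ∘ proj₂) e) (toℕ-mod j′ p)))

  ⟨toℕ,toℕ⟩ : ∀ i j → ⟨ toℕ i , toℕ j ⟩ ≡ (i , j)
  ⟨toℕ,toℕ⟩ i j = cong₂ _,_ (fromℕ<-toℕ i) (fromℕ<-toℕ j)
    where
    fromℕ<-toℕ : ∀ {n} .{{_ : NonZero n}} (i : Fin n) → fromℕ< (m%n<n (toℕ i) n) ≡ i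
    fromℕ<-toℕ i = trans (Finₚ.fromℕ<-cong _ _ (m<n⇒m%n≡m (Finₚ.toℕ<n i)) _ (Finₚ.toℕ<n i))
                         (Finₚ.fromℕ<-toℕ i (Finₚ.toℕ<n i))

  data NormalForm : El → Set where
    ⟨_,_⟩ⁿᶠ : ∀ x j → NormalForm ⟨ x , j ⟩

  normalForm : ∀ g → NormalForm g
  normalForm (i , j) = subst NormalForm (⟨toℕ,toℕ⟩ i j) ⟨ toℕ i , toℕ j ⟩ⁿᶠ

  r^s≡1+sq : ∀ s → r ^ s ≡ 1 + s * q mod m
  r^s≡1+sq zero    = ≡-mod-refl
  r^s≡1+sq (suc s) = begin
    r * r ^ s                        ≈⟨ *-cong-mod (≡-mod-refl {x = r}) (r^s≡1+sq s) ⟩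
    r * (1 + s * q)                  ≡⟨ expand s p (p ^ t) ⟩
    1 + suc s * q + s * p ^ t * m    ≈⟨ +-*-≡-mod _ (s * p ^ t) ⟩
    1 + suc s * q                    ∎
    where
    open ≡-mod-Reasoning
    expand : ∀ s p P → (1 + p * P) * (1 + s * (p * P)) ≡ 1 + suc s * (p * P) + s * P * (p * (p * P))
    expand = solve-∀

  ·-⟨⟩ : ∀ x j y l → ⟨ x , j ⟩ · ⟨ y , l ⟩ ≡ ⟨ x + y + j * y * q , j + l ⟩
  ·-⟨⟩ x j y l = ⟨⟩-cong (begin
    toℕ (proj₁ ⟨ x , j ⟩) + toℕ (proj₁ ⟨ y , l ⟩) * r ^ toℕ (proj₂ ⟨ x , j ⟩)
      ≡⟨ cong₂ _+_ (toℕ-mod x m) (cong₂ (λ a b → a * r ^ b) (toℕ-mod y m) (toℕ-mod j p)) ⟩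
    x % m + y % m * r ^ (j % p)
      ≈⟨ +-cong-mod (%-≡-mod x) (*-cong-mod (%-≡-mod y) (r^s≡1+sq (j % p))) ⟩
    x + y * (1 + j % p * q)
      ≈⟨ +-*-≡-mod _ (y * (j / p)) ⟨
    x + y * (1 + j % p * q) + y * (j / p) * m
      ≡⟨ regroup x y (j % p) (j / p) p (p ^ t) ⟩
    x + y + (j % p + j / p * p) * y * q
      ≡⟨ cong (λ i → x + y + i * y * q) (m≡m%n+[m/n]*n j p) ⟨
    x + y + j * y * q ∎)
    (+-cong-mod (reduce j) (reduce l))
    where
    open ≡-mod-Reasoning
    reduce : ∀ a → toℕ (fromℕ< (m%n<n a p)) ≡ a mod p
    reduce a = ≡-mod-trans (≡⇒≡-mod (toℕ-mod a p)) (%-≡-mod a)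
    regroup : ∀ x y a b p P →
      x + y * (1 + a * (p * P)) + y * b * (p * (p * P)) ≡ x + y + (a + b * p) * y * (p * P)
    regroup = solve-∀

  ·-assoc : ∀ f g h → (f · g) · h ≡ f · (g · h)
  ·-assoc f g h with normalForm f | normalForm g | normalForm h
  ... | ⟨ x , j ⟩ⁿᶠ | ⟨ y , l ⟩ⁿᶠ | ⟨ z , s ⟩ⁿᶠ = begin
    (⟨ x , j ⟩ · ⟨ y , l ⟩) · ⟨ z , s ⟩
      ≡⟨ cong (_· ⟨ z , s ⟩) (·-⟨⟩ x j y l) ⟩
    ⟨ x + y + j * y * q , j + l ⟩ · ⟨ z , s ⟩
      ≡⟨ ·-⟨⟩ _ _ z s ⟩
    ⟨ x + y + j * y * q + z + (j + l) * z * q , j + l + s ⟩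
      ≡⟨ ⟨⟩-cong (≡-mod-sym (≡[m+kn]⇒≡-mod (j * l * z * p ^ t) (expand x j y l z p (p ^ t))))
                 (≡⇒≡-mod (+-assoc j l s)) ⟩
    ⟨ x + (y + z + l * z * q) + j * (y + z + l * z * q) * q , j + (l + s) ⟩
      ≡⟨ ·-⟨⟩ x j _ _ ⟨
    ⟨ x , j ⟩ · ⟨ y + z + l * z * q , l + s ⟩
      ≡⟨ cong (⟨ x , j ⟩ ·_) (·-⟨⟩ y l z s) ⟨
    ⟨ x , j ⟩ · (⟨ y , l ⟩ · ⟨ z , s ⟩) ∎
    where
    open ≡-Reasoning
    expand : ∀ x j y l z p P →
      x + (y + z + l * z * (p * P)) + j * (y + z + l * z * (p * P)) * (p * P)
        ≡ x + y + j * y * (p * P) + z + (j + l) * z * (p * P) + j * l * z * P * (p * (p * P))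
    expand = solve-∀

  ·-identityˡ : ∀ g → e · g ≡ g
  ·-identityˡ g with normalForm g
  ... | ⟨ x , j ⟩ⁿᶠ = trans (·-⟨⟩ 0 0 x j) (cong ⟨_, j ⟩ (+-identityʳ x))

  ·-identityʳ : ∀ g → g · e ≡ g
  ·-identityʳ g with normalForm g
  ... | ⟨ x , j ⟩ⁿᶠ = trans (·-⟨⟩ x j 0 0) (cong₂ ⟨_,_⟩ (vanish x j q) (+-identityʳ j))
    where
    vanish : ∀ x j q → x + 0 + j * 0 * q ≡ x
    vanish = solve-∀

  pow : El → ℕ → El
  pow g zero    = e
  pow g (suc s) = pow g s · g

  pow-⟨⟩ : ∀ x j s → pow ⟨ x , j ⟩ s ≡ ⟨ s * x + tri s * (j * x * q) , s * j ⟩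
  pow-⟨⟩ x j zero    = refl
  pow-⟨⟩ x j (suc s) = begin
    pow ⟨ x , j ⟩ s · ⟨ x , j ⟩
      ≡⟨ cong (_· ⟨ x , j ⟩) (pow-⟨⟩ x j s) ⟩
    ⟨ s * x + tri s * (j * x * q) , s * j ⟩ · ⟨ x , j ⟩
      ≡⟨ ·-⟨⟩ _ _ x j ⟩
    ⟨ s * x + tri s * (j * x * q) + x + s * j * x * q , s * j + j ⟩
      ≡⟨ cong₂ ⟨_,_⟩ (regroup s x (tri s) j q) (+-comm (s * j) j) ⟩
    ⟨ suc s * x + tri (suc s) * (j * x * q) , suc s * j ⟩ ∎
    where
    open ≡-Reasoning
    regroup : ∀ s x T j q →
      s * x + T * (j * x * q) + x + s * j * x * q ≡ suc s * x + (T + s) * (j * x * q)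
    regroup = solve-∀

  pow-⟨a⟩ : ∀ x s → pow ⟨ x , 0 ⟩ s ≡ ⟨ s * x , 0 ⟩
  pow-⟨a⟩ x s = trans (pow-⟨⟩ x 0 s) (cong₂ ⟨_,_⟩ (vanish s x (tri s) q) (*-zeroʳ s))
    where
    vanish : ∀ s x T q → s * x + T * (0 * x * q) ≡ s * x
    vanish = solve-∀

  [a^y·b]^p : ∀ y → pow ⟨ y , 1 ⟩ p ≡ ⟨ p * (y * (1 + tri p * p ^ t)) , 0 ⟩
  [a^y·b]^p y = trans (pow-⟨⟩ y 1 p)
    (⟨⟩-cong (≡⇒≡-mod (regroup p y (tri p) (p ^ t))) (∣⇒≡0-mod (m∣m*n 1)))
    where
    regroup : ∀ p y T P → p * y + T * (1 * y * (p * P)) ≡ p * (y * (1 + T * P))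
    regroup = solve-∀

  ·-pow-comm : ∀ g s → g · pow g s ≡ pow g (suc s)
  ·-pow-comm g zero    = trans (·-identityʳ g) (sym (·-identityˡ g))
  ·-pow-comm g (suc s) = begin
    g · (pow g s · g)   ≡⟨ ·-assoc g (pow g s) g ⟨
    (g · pow g s) · g   ≡⟨ cong (_· g) (·-pow-comm g s) ⟩
    pow g (suc s) · g   ∎
    where open ≡-Reasoning

  pow-[m+m]≡e : ∀ g → pow g (m + m) ≡ e
  pow-[m+m]≡e g with normalForm g
  ... | ⟨ x , j ⟩ⁿᶠ = trans (pow-⟨⟩ x j (m + m)) (⟨⟩-cong
    (∣⇒≡0-mod (∣m∣n⇒∣m+n (∣m⇒∣m*n x (∣m∣n⇒∣m+n ∣-refl ∣-refl))
                         (∣m⇒∣m*n (j * x * q) (n∣tri[n+n] m))))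
    (∣⇒≡0-mod (∣m⇒∣m*n j (∣m∣n⇒∣m+n (m∣m*n q) (m∣m*n q)))))

  inverse : El → El
  inverse g = pow g (pred m + m)

  ·-inverseˡ : ∀ g → inverse g · g ≡ e
  ·-inverseˡ g = trans (cong (pow g) (cong (_+ m) (suc-pred m))) (pow-[m+m]≡e g)

  ·-inverseʳ : ∀ g → g · inverse g ≡ e
  ·-inverseʳ g = trans (·-pow-comm g (pred m + m)) (·-inverseˡ g)

  _∈?_ : ∀ g H → Dec (g ∈ H)
  (i , j) ∈? H = lookup (lookup H i) j Boolₚ.≟ true

  _≟El_ : (g h : El) → Dec (g ≡ h)
  _≟El_ = Productₚ.≡-dec Finₚ._≟_ Finₚ._≟_

  _≟Sub_ : (H K : Sub) → Dec (H ≡ K)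
  _≟Sub_ = Vecₚ.≡-dec (Vecₚ.≡-dec Boolₚ._≟_)

  ∀-El? : Searchable El
  ∀-El? P? = map′ (λ ∀P (i , j) → ∀P i j) (λ ∀P i j → ∀P (i , j))
    (Finₚ.all? λ i → Finₚ.all? λ j → P? (i , j))

  ∃-El? : ∀ {P : El → Set} → Decidable P → Dec (∃ P)
  ∃-El? P? = map′ (λ (i , j , Pij) → (i , j) , Pij) (λ ((i , j) , Pij) → i , j , Pij)
    (Finₚ.any? λ i → Finₚ.any? λ j → P? (i , j))

  ∀-Sub? : Searchable Sub
  ∀-Sub? = ∀-Vec? (∀-Vec? ∀-Bool? p) m

  isSubgroup? : ∀ H → Dec (IsSubgroup H)
  isSubgroup? H = map′
    (λ (e∈ , ·-closed , inv-closed) → record { e∈ = e∈ ; ·-closed = ·-closed ; inv-closed = inv-closed })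
    (λ H≤G → IsSubgroup.e∈ H≤G , IsSubgroup.·-closed H≤G , IsSubgroup.inv-closed H≤G)
    ((e ∈? H) ×-dec (∀-El? λ g → ∀-El? λ h → (g ∈? H) →-dec (h ∈? H) →-dec ((g · h) ∈? H))
              ×-dec (∀-El? λ g → (g ∈? H) →-dec ∃-El? λ h → (h ∈? H) ×-dec ((g · h) ≟El e)))

  isTrivial? : ∀ H → Dec (IsTrivial H)
  isTrivial? H = ∀-El? λ g → (g ∈? H) ⇔? (g ≟El e)

  isWhole? : ∀ H → Dec (IsWhole H)
  isWhole? H = ∀-El? (_∈? H)

  isNormal? : ∀ H → Dec (IsNormal H)
  isNormal? H = ∀-El? λ g → ∀-El? λ g′ → ∀-El? λ h →
    ((g · g′) ≟El e) →-dec (h ∈? H) →-dec (((g · h) · g′) ∈? H)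

  permutable? : ∀ H K → Dec (Permutable H K)
  permutable? H K = ∀-El? λ x → product? H K x ⇔? product? K H x
    where
    product? : ∀ H K x → Dec (∃₂ λ h k → h ∈ H × k ∈ K × x ≡ h · k)
    product? H K x = ∃-El? λ h → ∃-El? λ k → (h ∈? H) ×-dec (k ∈? K) ×-dec (x ≟El (h · k))

  vertΓ? : ∀ H → Dec (VertΓ H)
  vertΓ? H = isSubgroup? H ×-dec ¬? (isTrivial? H) ×-dec ¬? (isWhole? H)

  vertΓN? : ∀ H → Dec (VertΓN H)
  vertΓN? H = isSubgroup? H ×-dec ¬? (isWhole? H) ×-dec ¬? (isNormal? H)

  IsIsoVia : (Sub → Set) → (T : FinGraph) → (Fin (size T) → Sub) → Set
  IsIsoVia Vert T f =
    (∀ i → Vert (f i)) × (∀ i j → f i ≡ f j → i ≡ j) × (∀ H → Vert H → ∃ λ i → f i ≡ H) ×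
    (∀ i j → i ≢ j → (Permutable (f i) (f j) ⇔ Adj T i j))

  isIsoVia? : ∀ {Vert} → (∀ H → Dec (Vert H)) → ∀ T → AdjDecidable T → ∀ f → Dec (IsIsoVia Vert T f)
  isIsoVia? Vert? T adj? f =
          Finₚ.all? (λ i → Vert? (f i))
    ×-dec Finₚ.all? (λ i → Finₚ.all? λ j → (f i ≟Sub f j) →-dec (i Finₚ.≟ j))
    ×-dec ∀-Sub? (λ H → Vert? H →-dec Finₚ.any? λ i → f i ≟Sub H)
    ×-dec Finₚ.all? (λ i → Finₚ.all? λ j → ¬? (i Finₚ.≟ j) →-dec (permutable? (f i) (f j) ⇔? adj? i j))

  -- Subgroups, normality and permutability

  pow-closed : ∀ H {g} → e ∈ H → (∀ g h → g ∈ H → h ∈ H → (g · h) ∈ H) → g ∈ H → ∀ s → pow g s ∈ H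
  pow-closed H e∈H ·-closed g∈H zero    = e∈H
  pow-closed H e∈H ·-closed g∈H (suc s) = ·-closed _ _ (pow-closed H e∈H ·-closed g∈H s) g∈H

  closed⇒subgroup : ∀ {H} → e ∈ H → (∀ g h → g ∈ H → h ∈ H → (g · h) ∈ H) → IsSubgroup H
  closed⇒subgroup {H} e∈H ·-closed = record
    { e∈         = e∈H
    ; ·-closed   = ·-closed
    ; inv-closed = λ g g∈H → inverse g , pow-closed H e∈H ·-closed g∈H (pred m + m) , ·-inverseʳ g
    }

  module Subgroup {H : Sub} (H≤G : IsSubgroup H) where
    open IsSubgroup H≤G public

    pow∈ : ∀ {g} → g ∈ H → ∀ s → pow g s ∈ H
    pow∈ = pow-closed H e∈ ·-closed

    ⟨a⟩-closed : ∀ {x} k → ⟨ x , 0 ⟩ ∈ H → ⟨ k * x , 0 ⟩ ∈ H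
    ⟨a⟩-closed {x} k x∈H = subst (_∈ H) (pow-⟨a⟩ x k) (pow∈ x∈H k)

    ∈-cancelʳ : ∀ {f g} → g ∈ H → (f · g) ∈ H → f ∈ H
    ∈-cancelʳ {f} {g} g∈H fg∈H = subst (_∈ H) (begin
      (f · g) · inverse g   ≡⟨ ·-assoc f g (inverse g) ⟩
      f · (g · inverse g)   ≡⟨ cong (f ·_) (·-inverseʳ g) ⟩
      f · e                 ≡⟨ ·-identityʳ f ⟩
      f                     ∎) (·-closed _ _ fg∈H (pow∈ g∈H (pred m + m)))
      where open ≡-Reasoning

  conjugate-right : ∀ h k → h · k ≡ k · ((inverse k · h) · k)
  conjugate-right h k = sym (begin
    k · ((inverse k · h) · k)   ≡⟨ ·-assoc k _ k ⟨
    (k · (inverse k · h)) · k   ≡⟨ cong (_· k) (·-assoc k (inverse k) h) ⟨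
    ((k · inverse k) · h) · k   ≡⟨ cong (λ u → (u · h) · k) (·-inverseʳ k) ⟩
    (e · h) · k                 ≡⟨ cong (_· k) (·-identityˡ h) ⟩
    h · k                       ∎)
    where open ≡-Reasoning

  conjugate-left : ∀ k h → k · h ≡ ((k · h) · inverse k) · k
  conjugate-left k h = sym (begin
    ((k · h) · inverse k) · k   ≡⟨ ·-assoc (k · h) (inverse k) k ⟩
    (k · h) · (inverse k · k)   ≡⟨ cong ((k · h) ·_) (·-inverseˡ k) ⟩
    (k · h) · e                 ≡⟨ ·-identityʳ (k · h) ⟩
    k · h                       ∎)
    where open ≡-Reasoning

  normal⇒permutable : ∀ N K → IsNormal N → Permutable N K
  normal⇒permutable N K N⊴G x = mk⇔
    (λ (h , k , h∈N , k∈K , x≡hk) → k , (inverse k · h) · k , k∈K ,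
      N⊴G (inverse k) k h (·-inverseˡ k) h∈N , trans x≡hk (conjugate-right h k))
    (λ (k , h , k∈K , h∈N , x≡kh) → (k · h) · inverse k , k ,
      N⊴G k (inverse k) h (·-inverseʳ k) h∈N , k∈K , trans x≡kh (conjugate-left k h))

  permutable-sym : ∀ H K → Permutable H K → Permutable K H
  permutable-sym H K H∼K x = ⇔-sym (H∼K x)

  commuting⇒permutable : ∀ H K → (∀ h k → h ∈ H → k ∈ K → h · k ≡ k · h) → Permutable H K
  commuting⇒permutable H K comm x = mk⇔
    (λ (h , k , h∈H , k∈K , x≡hk) → k , h , k∈K , h∈H , trans x≡hk (comm h k h∈H k∈K))
    (λ (k , h , k∈K , h∈H , x≡kh) → h , k , h∈H , k∈K , trans x≡kh (sym (comm h k h∈H k∈K)))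

  trivial⇒normal : ∀ {H} → IsSubgroup H → IsTrivial H → IsNormal H
  trivial⇒normal {H} H≤G trivial g g′ h gg′≡e h∈H = subst (_∈ H) (sym (begin
    (g · h) · g′   ≡⟨ cong (λ h → (g · h) · g′) (Equivalence.to (trivial h) h∈H) ⟩
    (g · e) · g′   ≡⟨ cong (_· g′) (·-identityʳ g) ⟩
    g · g′         ≡⟨ gg′≡e ⟩
    e              ∎)) (IsSubgroup.e∈ H≤G)
    where open ≡-Reasoning

  private
    swap-exponent : ∀ x y j l → let z = l * x + pred p * (j * y) in
      x + z * q + j * (z * q) * q + y + (j + 0) * y * q ≡ y + x + l * x * q mod m
    swap-exponent x y j l = begin
      x + z * q + j * (z * q) * q + y + (j + 0) * y * q
        ≡⟨ regroup x y j l (pred p * (j * y)) p (p ^ t) ⟩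
      y + x + l * x * q + (j * y + pred p * (j * y)) * q + j * z * p ^ t * m
        ≈⟨ +-*-≡-mod _ (j * z * p ^ t) ⟩
      y + x + l * x * q + (j * y + pred p * (j * y)) * q
        ≈⟨ +-cong-mod ≡-mod-refl (*-≡-mod q (+-inverse-mod (j * y))) ⟩
      y + x + l * x * q + 0
        ≡⟨ +-identityʳ _ ⟩
      y + x + l * x * q ∎
      where
      z = l * x + pred p * (j * y)
      open ≡-mod-Reasoning
      regroup : ∀ x y j l w p P → let z = l * x + w in
        x + z * (p * P) + j * (z * (p * P)) * (p * P) + y + (j + 0) * y * (p * P)
          ≡ y + x + l * x * (p * P) + (j * y + w) * (p * P) + j * z * P * (p * (p * P))
      regroup = solve-∀

  ·-swap : ∀ g h → ∃ λ z → g · h ≡ (h · ⟨ z * q , 0 ⟩) · g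
  ·-swap g h with normalForm g | normalForm h
  ... | ⟨ y , l ⟩ⁿᶠ | ⟨ x , j ⟩ⁿᶠ = z , sym (begin
    (⟨ x , j ⟩ · ⟨ z * q , 0 ⟩) · ⟨ y , l ⟩
      ≡⟨ cong (_· ⟨ y , l ⟩) (·-⟨⟩ x j (z * q) 0) ⟩
    ⟨ x + z * q + j * (z * q) * q , j + 0 ⟩ · ⟨ y , l ⟩
      ≡⟨ ·-⟨⟩ _ _ y l ⟩
    ⟨ x + z * q + j * (z * q) * q + y + (j + 0) * y * q , j + 0 + l ⟩
      ≡⟨ ⟨⟩-cong (swap-exponent x y j l) (≡⇒≡-mod (trans (cong (_+ l) (+-identityʳ j)) (+-comm j l))) ⟩
    ⟨ y + x + l * x * q , l + j ⟩
      ≡⟨ ·-⟨⟩ y l x j ⟨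
    ⟨ y , l ⟩ · ⟨ x , j ⟩ ∎)
    where
    z = l * x + pred p * (j * y)
    open ≡-Reasoning

  aq∈⇒normal : ∀ {N} → IsSubgroup N → ⟨ q , 0 ⟩ ∈ N → IsNormal N
  aq∈⇒normal {N} N≤G aq∈N g g′ h gg′≡e h∈N with ·-swap g h
  ... | z , gh≡hcg = subst (_∈ N) (sym (begin
    (g · h) · g′                     ≡⟨ cong (_· g′) gh≡hcg ⟩
    ((h · ⟨ z * q , 0 ⟩) · g) · g′   ≡⟨ ·-assoc _ g g′ ⟩
    (h · ⟨ z * q , 0 ⟩) · (g · g′)   ≡⟨ cong (_ ·_) gg′≡e ⟩
    (h · ⟨ z * q , 0 ⟩) · e          ≡⟨ ·-identityʳ _ ⟩
    h · ⟨ z * q , 0 ⟩                ∎)) (·-closed _ _ h∈N (⟨a⟩-closed z aq∈N))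
    where
    open Subgroup N≤G
    open ≡-Reasoning

  -- The subgroups A k and B k c

  Sub-ext : ∀ {H K} → (∀ x j → ⟨ x , j ⟩ ∈ H ⇔ ⟨ x , j ⟩ ∈ K) → H ≡ K
  Sub-ext {H} {K} H≈K = Pointwise-≡⇒≡ (ext λ i → Pointwise-≡⇒≡ (ext λ j →
    Boolₚ.⇔→≡ (subst (λ g → g ∈ H ⇔ g ∈ K) (⟨toℕ,toℕ⟩ i j) (H≈K (toℕ i) (toℕ j)))))

  RespectsMod : (ℕ → ℕ → Set) → Set
  RespectsMod P = ∀ {x x′ j j′} → x ≡ x′ mod m → j ≡ j′ mod p → P x j → P x′ j′

  table : {P : ℕ → ℕ → Set} → (∀ x j → Dec (P x j)) → Sub
  table P? = tabulate λ i → tabulate λ j → does (P? (toℕ i) (toℕ j))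

  module _ {P : ℕ → ℕ → Set} (P? : ∀ x j → Dec (P x j)) (resp : RespectsMod P) {x j : ℕ} where
    private
      entry : lookup (lookup (table P?) (proj₁ ⟨ x , j ⟩)) (proj₂ ⟨ x , j ⟩) ≡ does (P? (x % m) (j % p))
      entry = begin
        lookup (lookup (table P?) i) k   ≡⟨ cong (λ row → lookup row k) (Vecₚ.lookup∘tabulate row i) ⟩
        lookup (row i) k                 ≡⟨ Vecₚ.lookup∘tabulate (λ k → does (P? (toℕ i) (toℕ k))) k ⟩
        does (P? (toℕ i) (toℕ k))        ≡⟨ cong₂ (λ a b → does (P? a b)) (toℕ-mod x m) (toℕ-mod j p) ⟩
        does (P? (x % m) (j % p))        ∎
        where
        open ≡-Reasoning
        i = proj₁ ⟨ x , j ⟩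
        k = proj₂ ⟨ x , j ⟩
        row = λ i → tabulate λ k → does (P? (toℕ i) (toℕ k))

    ∈-table⁺ : P x j → ⟨ x , j ⟩ ∈ table P?
    ∈-table⁺ Pxj = trans entry (Equivalence.from (does≡true⇔ (P? _ _))
      (resp (≡-mod-sym (%-≡-mod x)) (≡-mod-sym (%-≡-mod j)) Pxj))

    ∈-table⁻ : ⟨ x , j ⟩ ∈ table P? → P x j
    ∈-table⁻ x∈ = resp (%-≡-mod x) (%-≡-mod j) (Equivalence.to (does≡true⇔ (P? _ _)) (trans (sym entry) x∈))

  table-subgroup : ∀ {P} (P? : ∀ x j → Dec (P x j)) → RespectsMod P → P 0 0 →
                   (∀ {x j y l} → P x j → P y l → P (x + y + j * y * q) (j + l)) → IsSubgroup (table P?)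
  table-subgroup P? resp P00 P-closed = closed⇒subgroup (∈-table⁺ P? resp P00) closed
    where
    closed : ∀ g h → g ∈ table P? → h ∈ table P? → (g · h) ∈ table P?
    closed g h with normalForm g | normalForm h
    ... | ⟨ x , j ⟩ⁿᶠ | ⟨ y , l ⟩ⁿᶠ = λ g∈ h∈ → subst (_∈ table P?) (sym (·-⟨⟩ x j y l))
      (∈-table⁺ P? resp (P-closed (∈-table⁻ P? resp g∈) (∈-table⁻ P? resp h∈)))

  p^k∣m : ∀ {k} → k ≤ 2 + t → p ^ k ∣ m
  p^k∣m = ^-monoʳ-∣ p

  p^k∣y⇒p^[1+k]∣yq : ∀ {k y} → p ^ k ∣ y → p ^ suc k ∣ y * q
  p^k∣y⇒p^[1+k]∣yq {k} {y} p^k∣y = subst (_∣ y * q) (*-comm (p ^ k) p) (*-pres-∣ p^k∣y (m∣m*n (p ^ t)))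

  -- instance search cannot produce NonZero (p ^ k) for a variable k
  module PowerModuli (k : ℕ) where
    instance
      p^k≢0 : NonZero (p ^ k)
      p^k≢0 = m^n≢0 p k
      p^[1+k]≢0 : NonZero (p ^ suc k)
      p^[1+k]≢0 = m^n≢0 p (suc k)

  module _ (k : ℕ) where
    open PowerModuli k

    InA : ℕ → ℕ → Set
    InA x j = j ≡ 0 mod p × x ≡ 0 mod p ^ k

    InA? : ∀ x j → Dec (InA x j)
    InA? x j = (j ≡? 0 mod p) ×-dec (x ≡? 0 mod p ^ k)

    A : Sub
    A = table InA?

    -- B k c = ⟨ a ^ (p ^ (1 + k)) , a ^ (c p ^ k) b ⟩
    InB : ℕ → ℕ → ℕ → Set
    InB c x j = x ≡ j * c * p ^ k mod p ^ suc k

    InB? : ∀ c x j → Dec (InB c x j)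
    InB? c x j = x ≡? j * c * p ^ k mod p ^ suc k

    B : ℕ → Sub
    B c = table (InB? c)

  module _ {k : ℕ} (k≤ : k ≤ 2 + t) where
    open PowerModuli k

    A-respects : RespectsMod (InA k)
    A-respects x≡x′ j≡j′ (j≡0 , x≡0) =
      ≡-mod-trans (≡-mod-sym j≡j′) j≡0 , ≡-mod-trans (≡-mod-sym (≡-mod-∣ (p^k∣m k≤) x≡x′)) x≡0

    ∈A⁺ : ∀ {x j} → InA k x j → ⟨ x , j ⟩ ∈ A k
    ∈A⁺ = ∈-table⁺ (InA? k) A-respects

    ∈A⁻ : ∀ {x j} → ⟨ x , j ⟩ ∈ A k → InA k x j
    ∈A⁻ = ∈-table⁻ (InA? k) A-respects

    A-subgroup : IsSubgroup (A k)
    A-subgroup = table-subgroup (InA? k) A-respects (≡-mod-refl , ≡-mod-refl)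
      λ {x} {j} {y} (j≡0 , x≡0) (l≡0 , y≡0) → +-cong-mod j≡0 l≡0 ,
        +-cong-mod (+-cong-mod x≡0 y≡0) (≡-mod-∣ (p^k∣m k≤) (*-≡-mod q (*-cong-mod j≡0 (≡-mod-refl {x = y}))))

  module _ {k c : ℕ} (k≤ : k ≤ 1 + t) where
    open PowerModuli k

    B-respects : RespectsMod (InB k c)
    B-respects x≡x′ j≡j′ x≡jcp^k = ≡-mod-trans (≡-mod-sym (≡-mod-∣ (p^k∣m (s≤s k≤)) x≡x′))
      (≡-mod-trans x≡jcp^k (*-≡-mod (p ^ k) (*-cong-mod j≡j′ (≡-mod-refl {x = c}))))

    ∈B⁺ : ∀ {x j} → InB k c x j → ⟨ x , j ⟩ ∈ B k c
    ∈B⁺ = ∈-table⁺ (InB? k c) B-respects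

    ∈B⁻ : ∀ {x j} → ⟨ x , j ⟩ ∈ B k c → InB k c x j
    ∈B⁻ = ∈-table⁻ (InB? k c) B-respects

  module _ {k : ℕ} where
    open PowerModuli k

    InB⇒p^k∣x : ∀ {c x j} → InB k c x j → p ^ k ∣ x
    InB⇒p^k∣x {c} {x} {j} x≡jcp^k = ≡0-mod⇒∣ (≡-mod-trans (≡-mod-∣ (^-monoʳ-∣ p (n≤1+n k)) x≡jcp^k)
      (∣⇒≡0-mod (n∣m*n (j * c))))

    B-subgroup : ∀ {c} → k ≤ 1 + t → IsSubgroup (B k c)
    B-subgroup {c} k≤ = table-subgroup (InB? k c) (B-respects k≤) ≡-mod-refl λ {x} {j} {y} {l} x≡ y≡ →
      let p^[1+k]∣jyq = subst (p ^ suc k ∣_) (sym (*-assoc j y q))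
                              (∣n⇒∣m*n j (p^k∣y⇒p^[1+k]∣yq {k} (InB⇒p^k∣x {c} {y} {l} y≡)))
      in begin
        x + y + j * y * q                   ≈⟨ +-cong-mod (+-cong-mod x≡ y≡) (∣⇒≡0-mod p^[1+k]∣jyq) ⟩
        j * c * p ^ k + l * c * p ^ k + 0   ≡⟨ regroup j l c (p ^ k) ⟩
        (j + l) * c * p ^ k                 ∎
      where
      open ≡-mod-Reasoning
      regroup : ∀ j l c K → j * c * K + l * c * K + 0 ≡ (j + l) * c * K
      regroup = solve-∀

    a^p^k∈A : k ≤ 2 + t → ⟨ p ^ k , 0 ⟩ ∈ A k
    a^p^k∈A k≤ = ∈A⁺ k≤ (≡-mod-refl , ∣⇒≡0-mod ∣-refl)

    a^x∈A⇒p^k∣x : k ≤ 2 + t → ∀ {x} → ⟨ x , 0 ⟩ ∈ A k → p ^ k ∣ x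
    a^x∈A⇒p^k∣x k≤ x∈A = ≡0-mod⇒∣ (proj₂ (∈A⁻ k≤ x∈A))

    b∉A : k ≤ 2 + t → ∀ {x} → ¬ ⟨ x , 1 ⟩ ∈ A k
    b∉A k≤ x∈A = prime∤1 pr (≡0-mod⇒∣ (proj₁ (∈A⁻ k≤ x∈A)))

    aq∈A : k ≤ 1 + t → ⟨ q , 0 ⟩ ∈ A k
    aq∈A k≤ = ∈A⁺ (m≤n⇒m≤1+n k≤) (≡-mod-refl , ∣⇒≡0-mod (^-monoʳ-∣ p k≤))

    A-proper : k ≤ 2 + t → ¬ IsWhole (A k)
    A-proper k≤ whole = b∉A k≤ (whole ⟨ 0 , 1 ⟩)

    A-nontrivial : k ≤ 1 + t → ¬ IsTrivial (A k)
    A-nontrivial k≤ trivial = <⇒≱ (s≤s k≤) (^-cancelʳ-∣ (prime>1 pr) (≡0-mod⇒∣ (proj₁ (⟨⟩-injective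
      (Equivalence.to (trivial ⟨ p ^ k , 0 ⟩) (a^p^k∈A (m≤n⇒m≤1+n k≤)))))))

    generator∈B : ∀ {c} → k ≤ 1 + t → ⟨ c * p ^ k , 1 ⟩ ∈ B k c
    generator∈B {c} k≤ = ∈B⁺ k≤ (≡⇒≡-mod (cong (_* p ^ k) (sym (*-identityˡ c))))

    a^p^[1+k]∈B : ∀ {c} → k ≤ 1 + t → ⟨ p ^ suc k , 0 ⟩ ∈ B k c
    a^p^[1+k]∈B k≤ = ∈B⁺ k≤ (∣⇒≡0-mod ∣-refl)

    a^x∈B⇒p^[1+k]∣x : ∀ {c} → k ≤ 1 + t → ∀ {x} → ⟨ x , 0 ⟩ ∈ B k c → p ^ suc k ∣ x
    a^x∈B⇒p^[1+k]∣x k≤ x∈B = ≡0-mod⇒∣ (∈B⁻ k≤ x∈B)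

    aq∈B : ∀ {c} → k ≤ t → ⟨ q , 0 ⟩ ∈ B k c
    aq∈B k≤ = ∈B⁺ (m≤n⇒m≤1+n k≤) (∣⇒≡0-mod (^-monoʳ-∣ p (s≤s k≤)))

    B-proper : ∀ {c} → k ≤ 1 + t → ¬ IsWhole (B k c)
    B-proper k≤ whole = prime∤1 pr (∣-trans (m∣m*n (p ^ k)) (a^x∈B⇒p^[1+k]∣x k≤ (whole ⟨ 1 , 0 ⟩)))

    B-nontrivial : ∀ {c} → k ≤ 1 + t → ¬ IsTrivial (B k c)
    B-nontrivial {c} k≤ trivial = prime∤1 pr (≡0-mod⇒∣ (proj₂ (⟨⟩-injective
      (Equivalence.to (trivial ⟨ c * p ^ k , 1 ⟩) (generator∈B k≤)))))

  A-trivial : IsTrivial (A (2 + t))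
  A-trivial g with normalForm g
  ... | ⟨ x , j ⟩ⁿᶠ = mk⇔
    (λ g∈A → let j≡0 , x≡0 = ∈A⁻ ≤-refl g∈A in ⟨⟩-cong x≡0 j≡0)
    (λ g≡e → subst (_∈ A (2 + t)) (sym g≡e) (IsSubgroup.e∈ (A-subgroup ≤-refl)))

  A-normal : ∀ {k} → k ≤ 2 + t → IsNormal (A k)
  A-normal k≤ with m≤n⇒m<n∨m≡n k≤
  ... | inj₁ k<2+t = aq∈⇒normal (A-subgroup k≤) (aq∈A (s≤s⁻¹ k<2+t))
  ... | inj₂ refl  = trivial⇒normal (A-subgroup k≤) A-trivial

  B-normal : ∀ {k c} → k ≤ t → IsNormal (B k c)
  B-normal k≤ = aq∈⇒normal (B-subgroup (m≤n⇒m≤1+n k≤)) (aq∈B k≤)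

  A-injective : ∀ {k k′} → k ≤ 2 + t → k′ ≤ 2 + t → A k ≡ A k′ → k ≡ k′
  A-injective k≤ k′≤ A≡A′ = ≤-antisym (level k′≤ k≤ (sym A≡A′)) (level k≤ k′≤ A≡A′)
    where
    level : ∀ {k k′} → k ≤ 2 + t → k′ ≤ 2 + t → A k ≡ A k′ → k′ ≤ k
    level {k} k≤ k′≤ A≡A′ =
      ^-cancelʳ-∣ (prime>1 pr) (a^x∈A⇒p^k∣x k′≤ (subst (⟨ p ^ k , 0 ⟩ ∈_) A≡A′ (a^p^k∈A k≤)))

  private
    B-level : ∀ {k k′ c c′} → k ≤ 1 + t → k′ ≤ 1 + t → B k c ≡ B k′ c′ → k′ ≤ k
    B-level {k} k≤ k′≤ B≡B′ = s≤s⁻¹ (^-cancelʳ-∣ (prime>1 pr)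
      (a^x∈B⇒p^[1+k]∣x k′≤ (subst (⟨ p ^ suc k , 0 ⟩ ∈_) B≡B′ (a^p^[1+k]∈B k≤))))

  B-injective : ∀ {k k′ c c′} → k ≤ 1 + t → k′ ≤ 1 + t → c < p → c′ < p →
                B k c ≡ B k′ c′ → k ≡ k′ × c ≡ c′
  B-injective {k} {k′} {c} {c′} k≤ k′≤ c<p c′<p B≡B′
    with refl ← ≤-antisym (B-level k′≤ k≤ (sym B≡B′)) (B-level k≤ k′≤ B≡B′)
    = refl , *-cancelʳ-≡ c c′ (p ^ k) (≡-mod⇒≡ (*-monoˡ-< (p ^ k) c<p) (*-monoˡ-< (p ^ k) c′<p)
        (≡-mod-trans (∈B⁻ k′≤ (subst (⟨ c * p ^ k , 1 ⟩ ∈_) B≡B′ (generator∈B k≤)))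
                     (≡⇒≡-mod (cong (_* p ^ k) (*-identityˡ c′)))))
    where open PowerModuli k

  A≢B : ∀ {k k′ c} → k ≤ 2 + t → k′ ≤ 1 + t → A k ≢ B k′ c
  A≢B {k′ = k′} {c} k≤ k′≤ A≡B = b∉A k≤ (subst (⟨ c * p ^ k′ , 1 ⟩ ∈_) (sym A≡B) (generator∈B k′≤))

  private
    q∣x⇒m∣jxq : ∀ {x} → q ∣ x → ∀ j → j * x * q ≡ 0 mod m
    q∣x⇒m∣jxq {x} q∣x j =
      ∣⇒≡0-mod (subst (m ∣_) (sym (*-assoc j x q)) (∣n⇒∣m*n j (p^k∣y⇒p^[1+k]∣yq {1 + t} q∣x)))

    B-top-exponents-commute : ∀ {c c′ x j y l} → InB (1 + t) c x j → InB (1 + t) c′ y l →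
                              x + y + j * y * q ≡ y + x + l * x * q mod m
    B-top-exponents-commute {c} {c′} {x} {j} {y} {l} x∈ y∈ = begin
      x + y + j * y * q  ≈⟨ +-cong-mod ≡-mod-refl (q∣x⇒m∣jxq (InB⇒p^k∣x {1 + t} {c′} {y} {l} y∈) j) ⟩
      x + y + 0          ≡⟨ trans (+-identityʳ (x + y)) (+-comm x y) ⟩
      y + x              ≡⟨ +-identityʳ (y + x) ⟨
      y + x + 0          ≈⟨ +-cong-mod ≡-mod-refl (q∣x⇒m∣jxq (InB⇒p^k∣x {1 + t} {c} {x} {j} x∈) l) ⟨
      y + x + l * x * q  ∎
      where open ≡-mod-Reasoning

    a^[m∸1]·a≡e : ⟨ pred m , 0 ⟩ · ⟨ 1 , 0 ⟩ ≡ e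
    a^[m∸1]·a≡e = trans (·-⟨⟩ (pred m) 0 1 0) (⟨⟩-cong (∣⇒≡0-mod (divides 1 (begin
      pred m + 1 + 0   ≡⟨ +-identityʳ _ ⟩
      pred m + 1       ≡⟨ +-comm (pred m) 1 ⟩
      suc (pred m)     ≡⟨ suc-pred m ⟩
      m                ≡⟨ *-identityˡ m ⟨
      1 * m            ∎))) ≡-mod-refl)
      where open ≡-Reasoning

  B-top-commute : ∀ c c′ g h → g ∈ B (1 + t) c → h ∈ B (1 + t) c′ → g · h ≡ h · g
  B-top-commute c c′ g h g∈B h∈B with normalForm g | normalForm h
  ... | ⟨ x , j ⟩ⁿᶠ | ⟨ y , l ⟩ⁿᶠ = begin
    ⟨ x , j ⟩ · ⟨ y , l ⟩           ≡⟨ ·-⟨⟩ x j y l ⟩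
    ⟨ x + y + j * y * q , j + l ⟩   ≡⟨ ⟨⟩-cong exponents (≡⇒≡-mod (+-comm j l)) ⟩
    ⟨ y + x + l * x * q , l + j ⟩   ≡⟨ ·-⟨⟩ y l x j ⟨
    ⟨ y , l ⟩ · ⟨ x , j ⟩           ∎
    where
    open ≡-Reasoning
    exponents = B-top-exponents-commute {c} {c′} {x} {j} {y} {l}
                  (∈B⁻ {c = c} ≤-refl {x} {j} g∈B) (∈B⁻ {c = c′} ≤-refl {y} {l} h∈B)

  B-top-not-normal : ∀ {c} → ¬ IsNormal (B (1 + t) c)
  B-top-not-normal {c} normal = <⇒≱ q<m (∣⇒≤ (≡0-mod⇒∣ q≡0))
    where
    q<m : q < m
    q<m = ^-monoʳ-< p (prime>1 pr) {1 + t} {2 + t} ≤-refl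
    X = pred m + c * q + 0 + 1 + 1 * 1 * q
    conjugate∈B : ⟨ X , 1 ⟩ ∈ B (1 + t) c
    conjugate∈B = subst (_∈ B (1 + t) c)
      (trans (cong (_· ⟨ 1 , 0 ⟩) (·-⟨⟩ (pred m) 0 (c * q) 1)) (·-⟨⟩ _ _ 1 0))
      (normal ⟨ pred m , 0 ⟩ ⟨ 1 , 0 ⟩ ⟨ c * q , 1 ⟩ a^[m∸1]·a≡e (generator∈B ≤-refl))
    regroup : ∀ M c q → q + c * q + 1 * suc M ≡ M + c * q + 0 + 1 + 1 * 1 * q
    regroup = solve-∀
    open ≡-mod-Reasoning
    q≡0 : q ≡ 0 mod m
    q≡0 = +-cancelʳ-mod (c * q) (begin
      q + c * q                       ≈⟨ +-*-≡-mod (q + c * q) 1 ⟨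
      q + c * q + 1 * m               ≡⟨ cong (λ n → q + c * q + 1 * n) (suc-pred m) ⟨
      q + c * q + 1 * suc (pred m)    ≡⟨ regroup (pred m) c q ⟩
      X                               ≈⟨ ∈B⁻ {c = c} ≤-refl {X} {1} conjugate∈B ⟩
      1 * c * q                       ≡⟨ cong (_* q) (*-identityˡ c) ⟩
      0 + c * q                       ∎)

  -- Classification of the subgroups

  p^[1+k]∣p*y*u⇒p^k∣y : p ^ (3 + t) ≢ 8 → ∀ k {y} → p ^ suc k ∣ p * (y * (1 + tri p * p ^ t)) → p ^ k ∣ y
  p^[1+k]∣p*y*u⇒p^k∣y p^α≢8 k {y} p^[1+k]∣pyu = coprime-divisor (∤⇒coprime-^ pr k (prime∤1+tri·p^t t pr p^α≢8))
    (subst (p ^ k ∣_) (*-comm y _) (*-cancelˡ-∣ p p^[1+k]∣pyu))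

  data Classification (H : Sub) : Set where
    ≡A    : ∀ k → k ≤ 2 + t → H ≡ A k → Classification H
    ≡B    : ∀ k c → k ≤ 1 + t → c < p → H ≡ B k c → Classification H
    whole : IsWhole H → Classification H

  module Classify {H : Sub} (H≤G : IsSubgroup H) where
    open Subgroup H≤G

    ∃a^y·b∈H : ∀ {x j} → ⟨ x , j ⟩ ∈ H → ¬ p ∣ j → ∃ λ y → ⟨ y , 1 ⟩ ∈ H
    ∃a^y·b∈H {x} {j} g∈H p∤j with bézout-mod j p
    ... | s , sj≡gcd = _ , subst (_∈ H) (trans (pow-⟨⟩ x j s) (⟨⟩-cong ≡-mod-refl sj≡1)) (pow∈ g∈H s)
      where
      sj≡1 : s * j ≡ 1 mod p
      sj≡1 = ≡-mod-trans sj≡gcd (≡⇒≡-mod (coprime⇒gcd≡1 (∤⇒coprime pr p∤j)))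

    Least : ℕ → Set
    Least k = ∀ {v} → v < k → ¬ ⟨ p ^ v , 0 ⟩ ∈ H

    -- H ∩ ⟨ a ⟩ = A k, where k is least with a ^ (p ^ k) ∈ H
    module AtLevel {k : ℕ} (k≤ : k ≤ 2 + t) (a^p^k∈H : ⟨ p ^ k , 0 ⟩ ∈ H) (least : Least k) where
      open PowerModuli k

      a^x∈H⁺ : ∀ {x} → x ≡ 0 mod p ^ k → ⟨ x , 0 ⟩ ∈ H
      a^x∈H⁺ x≡0 with ≡0-mod⇒∣ x≡0
      ... | divides w refl = ⟨a⟩-closed w a^p^k∈H

      a^x∈H⁻ : ∀ {x} → ⟨ x , 0 ⟩ ∈ H → x ≡ 0 mod p ^ k
      a^x∈H⁻ {x} x∈H with bézout-mod x m | ∣p^n⇒≡p^v pr (2 + t) (gcd[m,n]∣n x m)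
      ... | s , sx≡gcd | v , _ , gcd≡p^v =
        ∣⇒≡0-mod (∣-trans (subst (p ^ k ∣_) (sym gcd≡p^v) (^-monoʳ-∣ p k≤v)) (gcd[m,n]∣m x m))
        where
        gcd∈H : ⟨ gcd x m , 0 ⟩ ∈ H
        gcd∈H = subst (_∈ H) (⟨⟩-cong sx≡gcd ≡-mod-refl) (⟨a⟩-closed s x∈H)
        k≤v : k ≤ v
        k≤v = ≮⇒≥ λ v<k → least v<k (subst (λ d → ⟨ d , 0 ⟩ ∈ H) gcd≡p^v gcd∈H)

      a^y·b∈H⇒p^k∣p*y*u : ∀ {y} → ⟨ y , 1 ⟩ ∈ H → p ^ k ∣ p * (y * (1 + tri p * p ^ t))
      a^y·b∈H⇒p^k∣p*y*u b∈H = ≡0-mod⇒∣ (a^x∈H⁻ (subst (_∈ H) ([a^y·b]^p _) (pow∈ b∈H p)))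

      -- a^x b^j = a^d · (a^y b)^j, and a^d ∈ H exactly when x ≡ j y (mod p^k)
      ∈H⇔x≡jy : ∀ {y} → ⟨ y , 1 ⟩ ∈ H → p ^ k ∣ y * q → ∀ x j → ⟨ x , j ⟩ ∈ H ⇔ x ≡ j * y mod p ^ k
      ∈H⇔x≡jy {y} b∈H p^k∣yq x j = mk⇔
        (λ x∈H → ≡-mod-trans (x≡w (a^x∈H⁻ (∈-cancelʳ w∈H (subst (_∈ H) (sym split) x∈H)))) w≡jy)
        (λ x≡jy → subst (_∈ H) split (·-closed _ _ (a^x∈H⁺ (d≡0 x≡jy)) w∈H))
        where
        w = j * y + tri j * (1 * y * q)
        d = x + pred m * w
        w∈H : ⟨ w , j ⟩ ∈ H
        w∈H = subst (_∈ H) (trans (pow-⟨⟩ y 1 j) (cong ⟨ w ,_⟩ (*-identityʳ j))) (pow∈ b∈H j)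
        w≡jy : w ≡ j * y mod p ^ k
        w≡jy = ≡-mod-trans (+-cong-mod ≡-mod-refl (∣⇒≡0-mod (∣n⇒∣m*n (tri j)
                 (subst (p ^ k ∣_) (cong (_* q) (sym (*-identityˡ y))) p^k∣yq))))
                 (≡⇒≡-mod (+-identityʳ (j * y)))
        d+w≡x : d + w ≡ x mod m
        d+w≡x = ≡-mod-trans (≡⇒≡-mod (trans (+-assoc x _ w) (cong (x +_) (+-comm (pred m * w) w))))
                  (≡-mod-trans (+-cong-mod ≡-mod-refl (+-inverse-mod w)) (≡⇒≡-mod (+-identityʳ x)))
        split : ⟨ d , 0 ⟩ · ⟨ w , j ⟩ ≡ ⟨ x , j ⟩
        split = trans (·-⟨⟩ d 0 w j) (⟨⟩-cong (≡-mod-trans (≡⇒≡-mod (+-identityʳ (d + w))) d+w≡x) ≡-mod-refl)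
        x≡w : d ≡ 0 mod p ^ k → x ≡ w mod p ^ k
        x≡w d≡0 = ≡-mod-trans (≡-mod-sym (≡-mod-∣ (p^k∣m k≤) d+w≡x)) (+-cong-mod d≡0 (≡-mod-refl {x = w}))
        d≡0 : x ≡ j * y mod p ^ k → d ≡ 0 mod p ^ k
        d≡0 x≡jy = ≡-mod-trans (+-cong-mod (≡-mod-trans x≡jy (≡-mod-sym w≡jy)) ≡-mod-refl)
                     (≡-mod-∣ (p^k∣m k≤) (+-inverse-mod w))

    private
      a^yp^k·b∈H⇒≡B : ∀ {k} (k≤ : suc k ≤ 2 + t) → ⟨ p ^ suc k , 0 ⟩ ∈ H → Least (suc k) →
                      ∀ {y} → ⟨ y * p ^ k , 1 ⟩ ∈ H → H ≡ B k (y % p)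
      a^yp^k·b∈H⇒≡B {k} k≤ a∈H least {y} b∈H = Sub-ext λ x j →
        ⇔-trans (∈H⇔x≡jy b∈H (p^k∣y⇒p^[1+k]∣yq {k} (n∣m*n y)) x j)
                (⇔-trans (jy≡jcp^k x j) (mk⇔ (∈B⁺ (s≤s⁻¹ k≤)) (∈B⁻ (s≤s⁻¹ k≤))))
        where
        open AtLevel k≤ a∈H least
        open PowerModuli k
        jy≡jcp^k : ∀ x j → x ≡ j * (y * p ^ k) mod p ^ suc k ⇔ x ≡ j * (y % p) * p ^ k mod p ^ suc k
        jy≡jcp^k x j = mk⇔ (λ x≡ → ≡-mod-trans x≡ jy≡) (λ x≡ → ≡-mod-trans x≡ (≡-mod-sym jy≡))
          where
          jy≡ : j * (y * p ^ k) ≡ j * (y % p) * p ^ k mod p ^ suc k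
          jy≡ = ≡-mod-trans (≡⇒≡-mod (sym (*-assoc j y (p ^ k))))
                  (*-≡-mod (p ^ k) (*-cong-mod (≡-mod-refl {x = j}) (≡-mod-sym (%-≡-mod y))))

      a^y·b∈H⇒classification : p ^ (3 + t) ≢ 8 → ∀ {k} → k ≤ 2 + t → ⟨ p ^ k , 0 ⟩ ∈ H → Least k →
                               ∀ {y} → ⟨ y , 1 ⟩ ∈ H → Classification H
      a^y·b∈H⇒classification _ {zero} k≤ a∈H least {y} b∈H = whole λ g → all∈H g
        where
        open AtLevel k≤ a∈H least
        all∈H : ∀ g → g ∈ H
        all∈H g with normalForm g
        ... | ⟨ x , j ⟩ⁿᶠ = Equivalence.from (∈H⇔x≡jy b∈H (1∣ _) x j) (≡-mod-1 x (j * y))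
      a^y·b∈H⇒classification p^α≢8 {suc k} k≤ a∈H least {y} b∈H =
        ≡B k (y₁ % p) (s≤s⁻¹ k≤) (m%n<n y₁ p)
           (a^yp^k·b∈H⇒≡B k≤ a∈H least (subst (λ y → ⟨ y , 1 ⟩ ∈ H) y≡y₁p^k b∈H))
        where
        open _∣_ (p^[1+k]∣p*y*u⇒p^k∣y p^α≢8 k {y} (AtLevel.a^y·b∈H⇒p^k∣p*y*u k≤ a∈H least b∈H))
          renaming (quotient to y₁; equality to y≡y₁p^k)

    a^m∈H : ⟨ p ^ (2 + t) , 0 ⟩ ∈ H
    a^m∈H = subst (_∈ H) (⟨⟩-cong (≡-mod-sym (∣⇒≡0-mod ∣-refl)) ≡-mod-refl) e∈

    classify : p ^ (3 + t) ≢ 8 → Classification H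
    classify p^α≢8 with minimal-witness (λ k → ⟨ p ^ k , 0 ⟩ ∈? H) a^m∈H
    ... | k , k≤ , a∈H , least with ∃-El? (λ g → (g ∈? H) ×-dec ¬? (toℕ (proj₂ g) ≡? 0 mod p))
    ... | yes ((i , j) , g∈H , j≢0) = a^y·b∈H⇒classification p^α≢8 k≤ a∈H least
          (proj₂ (∃a^y·b∈H (subst (_∈ H) (sym (⟨toℕ,toℕ⟩ i j)) g∈H) (j≢0 ∘ ∣⇒≡0-mod)))
    ... | no H⊆⟨a⟩ = ≡A k k≤ (Sub-ext λ x j → mk⇔
          (λ g∈H → ∈A⁺ k≤ (j≡0 g∈H , a^x∈H⁻ (subst (_∈ H) (⟨⟩-cong ≡-mod-refl (j≡0 g∈H)) g∈H)))
          (λ g∈A → let j≡0 , x≡0 = ∈A⁻ k≤ g∈A in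
                     subst (_∈ H) (⟨⟩-cong ≡-mod-refl (≡-mod-sym j≡0)) (a^x∈H⁺ x≡0)))
      where
      open AtLevel k≤ a∈H least
      j≡0 : ∀ {x j} → ⟨ x , j ⟩ ∈ H → j ≡ 0 mod p
      j≡0 {x} {j} g∈H = ≡-mod-trans
        (≡-mod-sym (proj₂ (⟨⟩-injective (⟨toℕ,toℕ⟩ (proj₁ ⟨ x , j ⟩) (proj₂ ⟨ x , j ⟩)))))
        (decidable-stable (toℕ (proj₂ ⟨ x , j ⟩) ≡? 0 mod p) λ j≢0 → H⊆⟨a⟩ (⟨ x , j ⟩ , g∈H , j≢0))

  -- The graphs for p ^ α ≢ 8

  module GeneralCase (p^α≢8 : p ^ (3 + t) ≢ 8) where

    non-normal : ∀ {H} → IsSubgroup H → ¬ IsNormal H → ∃ λ c → c < p × H ≡ B (1 + t) c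
    non-normal H≤G ¬normal with Classify.classify H≤G p^α≢8
    ... | ≡A k k≤ refl  = ⊥-elim (¬normal (A-normal k≤))
    ... | whole H-whole = ⊥-elim (¬normal λ _ _ _ _ _ → H-whole _)
    ... | ≡B k c k≤ c<p refl with m≤n⇒m<n∨m≡n k≤
    ...   | inj₁ k<1+t = ⊥-elim (¬normal (B-normal (s≤s⁻¹ k<1+t)))
    ...   | inj₂ refl  = c , c<p , refl

    ΓN-iso : IsoTo VertΓN (K p)
    ΓN-iso = (λ c → B (1 + t) (toℕ c))
           , (λ c → B-subgroup ≤-refl , B-proper ≤-refl , B-top-not-normal)
           , (λ c c′ B≡B′ → Finₚ.toℕ-injective
                (proj₂ (B-injective ≤-refl ≤-refl (Finₚ.toℕ<n c) (Finₚ.toℕ<n c′) B≡B′)))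
           , (λ H (H≤G , _ , ¬normal) → let c , c<p , H≡B = non-normal H≤G ¬normal in
                fromℕ< c<p , trans (cong (B (1 + t)) (Finₚ.toℕ-fromℕ< c<p)) (sym H≡B))
           , (λ c c′ c≢c′ → mk⇔ (λ _ → c≢c′) λ _ →
                commuting⇒permutable (B (1 + t) (toℕ c)) (B (1 + t) (toℕ c′)) (B-top-commute (toℕ c) (toℕ c′)))

    subgroupAt : Fin (2 + t) → Fin p ⊎ Fin 1 → Sub
    subgroupAt s (inj₁ c) = B (toℕ s) (toℕ c)
    subgroupAt s (inj₂ _) = A (toℕ s)

    position : Fin ((2 + t) * (p + 1)) → Fin (2 + t) × (Fin p ⊎ Fin 1)
    position = map₂ (splitAt p) ∘ remQuot (p + 1)

    position-combine : ∀ s v → position (combine s (join p 1 v)) ≡ (s , v)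
    position-combine s v = trans (cong (map₂ (splitAt p)) (Finₚ.remQuot-combine s (join p 1 v)))
                                 (cong (s ,_) (Finₚ.splitAt-join p 1 v))

    position-injective : ∀ i i′ → position i ≡ position i′ → i ≡ i′
    position-injective i i′ eq = begin
      i                                      ≡⟨ Finₚ.combine-remQuot (p + 1) i ⟨
      uncurry combine (remQuot (p + 1) i)    ≡⟨ cong (uncurry combine) (cong₂ _,_ (cong proj₁ eq) u≡u′) ⟩
      uncurry combine (remQuot (p + 1) i′)   ≡⟨ Finₚ.combine-remQuot (p + 1) i′ ⟩
      i′                                     ∎
      where
      open ≡-Reasoning
      u≡u′ : proj₂ (remQuot (p + 1) i) ≡ proj₂ (remQuot (p + 1) i′)
      u≡u′ = trans (sym (Finₚ.join-splitAt p 1 _))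
                   (trans (cong (join p 1 ∘ proj₂) eq) (Finₚ.join-splitAt p 1 _))

    vertex : Fin ((2 + t) * (p + 1)) → Sub
    vertex = uncurry subgroupAt ∘ position

    subgroupAt-vertex : ∀ s v → VertΓ (subgroupAt s v)
    subgroupAt-vertex s (inj₁ c) = B-subgroup s≤ , B-nontrivial s≤ , B-proper s≤
      where s≤ = s≤s⁻¹ (Finₚ.toℕ<n s)
    subgroupAt-vertex s (inj₂ _) = A-subgroup (m≤n⇒m≤1+n s≤) , A-nontrivial s≤ , A-proper (m≤n⇒m≤1+n s≤)
      where s≤ = s≤s⁻¹ (Finₚ.toℕ<n s)

    subgroupAt-injective : ∀ s s′ v v′ → subgroupAt s v ≡ subgroupAt s′ v′ → (s , v) ≡ (s′ , v′)
    subgroupAt-injective s s′ (inj₁ c) (inj₁ c′) eq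
      with s≡s′ , c≡c′ ← B-injective (s≤s⁻¹ (Finₚ.toℕ<n s)) (s≤s⁻¹ (Finₚ.toℕ<n s′))
                                     (Finₚ.toℕ<n c) (Finₚ.toℕ<n c′) eq
      = cong₂ _,_ (Finₚ.toℕ-injective s≡s′) (cong inj₁ (Finₚ.toℕ-injective c≡c′))
    subgroupAt-injective s s′ (inj₂ zero) (inj₂ zero) eq = cong (_, inj₂ zero)
      (Finₚ.toℕ-injective (A-injective (<⇒≤ (Finₚ.toℕ<n s)) (<⇒≤ (Finₚ.toℕ<n s′)) eq))
    subgroupAt-injective s s′ (inj₁ c) (inj₂ _) eq =
      ⊥-elim (A≢B (<⇒≤ (Finₚ.toℕ<n s′)) (s≤s⁻¹ (Finₚ.toℕ<n s)) (sym eq))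
    subgroupAt-injective s s′ (inj₂ _) (inj₁ c) eq =
      ⊥-elim (A≢B (<⇒≤ (Finₚ.toℕ<n s)) (s≤s⁻¹ (Finₚ.toℕ<n s′)) eq)

    vertex-injective : ∀ i i′ → vertex i ≡ vertex i′ → i ≡ i′
    vertex-injective i i′ eq =
      let s , v = position i ; s′ , v′ = position i′
      in position-injective i i′ (subgroupAt-injective s s′ v v′ eq)

    vertex-surjective : ∀ H → VertΓ H → ∃ λ i → vertex i ≡ H
    vertex-surjective H (H≤G , nontrivial , proper) with Classify.classify H≤G p^α≢8
    ... | whole H-whole = ⊥-elim (proper H-whole)
    ... | ≡B k c k≤ c<p refl = combine s (join p 1 v) ,
      trans (cong (uncurry subgroupAt) (position-combine s v))
            (cong₂ B (Finₚ.toℕ-fromℕ< (s≤s k≤)) (Finₚ.toℕ-fromℕ< c<p))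
      where
      s = fromℕ< (s≤s k≤)
      v = inj₁ (fromℕ< c<p)
    ... | ≡A k k≤ refl with m≤n⇒m<n∨m≡n k≤
    ...   | inj₂ refl  = ⊥-elim (nontrivial A-trivial)
    ...   | inj₁ k<2+t = combine s (join p 1 v) ,
      trans (cong (uncurry subgroupAt) (position-combine s v)) (cong A (Finₚ.toℕ-fromℕ< k<2+t))
      where
      s = fromℕ< k<2+t
      v = inj₂ zero

    normal-or-top : ∀ s v → IsNormal (subgroupAt s v) ⊎ ∃ λ c → subgroupAt s v ≡ B (1 + t) c
    normal-or-top s (inj₂ _) = inj₁ (A-normal (<⇒≤ (Finₚ.toℕ<n s)))
    normal-or-top s (inj₁ c) with m≤n⇒m<n∨m≡n (s≤s⁻¹ (Finₚ.toℕ<n s))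
    ... | inj₁ s<1+t = inj₁ (B-normal (s≤s⁻¹ s<1+t))
    ... | inj₂ s≡1+t = inj₂ (toℕ c , cong (λ k → B k (toℕ c)) s≡1+t)

    permutable : ∀ s v s′ v′ → Permutable (subgroupAt s v) (subgroupAt s′ v′)
    permutable s v s′ v′ with normal-or-top s v | normal-or-top s′ v′
    ... | inj₁ normal   | _               = normal⇒permutable (subgroupAt s v) (subgroupAt s′ v′) normal
    ... | inj₂ _        | inj₁ normal′    = permutable-sym (subgroupAt s′ v′) (subgroupAt s v)
                                              (normal⇒permutable (subgroupAt s′ v′) (subgroupAt s v) normal′)
    ... | inj₂ (c , eq) | inj₂ (c′ , eq′) rewrite eq | eq′ =
      commuting⇒permutable (B (1 + t) c) (B (1 + t) c′) (B-top-commute c c′)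

    Γ-iso : IsoTo VertΓ (K ((2 + t) * (p + 1)))
    Γ-iso = vertex
          , (λ i → subgroupAt-vertex (proj₁ (position i)) (proj₂ (position i)))
          , vertex-injective
          , vertex-surjective
          , (λ i i′ i≢i′ → mk⇔ (λ _ → i≢i′) λ _ →
              permutable (proj₁ (position i)) (proj₂ (position i)) (proj₁ (position i′)) (proj₂ (position i′)))

-- M₈ is the dihedral group D₈, in which the reflections a b and a³ b generate subgroups
-- outside the families A and B

module DihedralCase (pr : Prime 2) where
  open ModularGroup 2 0 pr

  ⟨ab⟩ ⟨a³b⟩ : Sub
  ⟨ab⟩  = (true  ∷ false ∷ []) ∷
          (false ∷ true  ∷ []) ∷
          (false ∷ false ∷ []) ∷
          (false ∷ false ∷ []) ∷ []
  ⟨a³b⟩ = (true  ∷ false ∷ []) ∷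
          (false ∷ false ∷ []) ∷
          (false ∷ false ∷ []) ∷
          (false ∷ true  ∷ []) ∷ []

  non-normal-subgroups : Fin 4 → Sub
  non-normal-subgroups = lookup (B 1 0 ∷ B 1 1 ∷ ⟨ab⟩ ∷ ⟨a³b⟩ ∷ [])

  proper-subgroups : Fin 8 → Sub
  proper-subgroups = lookup (A 0 ∷ A 1 ∷ B 0 0 ∷ B 0 1 ∷ B 1 0 ∷ B 1 1 ∷ ⟨ab⟩ ∷ ⟨a³b⟩ ∷ [])

  ΓN-iso : IsoTo VertΓN (K 2 ⊕ K 2)
  ΓN-iso = non-normal-subgroups ,
    from-yes (isIsoVia? vertΓN? (K 2 ⊕ K 2) (⊕-adj? (K-adj? 2) (K-adj? 2)) non-normal-subgroups)

  Γ-iso : IsoTo VertΓ (K 4 +ᴶ (K 2 ⊕ K 2))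
  Γ-iso = proper-subgroups ,
    from-yes (isIsoVia? vertΓ? (K 4 +ᴶ (K 2 ⊕ K 2)) (+ᴶ-adj? (K-adj? 4) (⊕-adj? (K-adj? 2) (K-adj? 2)))
                        proper-subgroups)

M₈-ΓN : ∀ {p t} (pr : Prime p) → p ≡ 2 × t ≡ 0 → ΓN≅ p (3 + t) pr (K 2 ⊕ K 2)
M₈-ΓN pr (refl , refl) = DihedralCase.ΓN-iso pr

M₈-Γ : ∀ {p t} (pr : Prime p) → p ≡ 2 × t ≡ 0 → Γ≅ p (3 + t) pr (K 4 +ᴶ (K 2 ⊕ K 2))
M₈-Γ pr (refl , refl) = DihedralCase.Γ-iso pr

theorem7p1 : (p α : ℕ) (pr : Prime p) → 3 ≤ α →
    ((p ^ α ≡ 8 → ΓN≅ p α pr (K 2 ⊕ K 2)) × (p ^ α ≢ 8 → ΓN≅ p α pr (K p))) ×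
    ((p ^ α ≡ 8 → Γ≅ p α pr (K 4 +ᴶ (K 2 ⊕ K 2))) × (p ^ α ≢ 8 → Γ≅ p α pr (K ((α ∸ 1) * (p + 1)))))
theorem7p1 p (suc (suc (suc t))) pr (s≤s (s≤s (s≤s z≤n))) =
  ( (λ p^α≡8 → M₈-ΓN pr (p^[3+t]≡8⇒p≡2∧t≡0 t pr p^α≡8))
  , (λ p^α≢8 → GeneralCase.ΓN-iso p^α≢8) ) ,
  ( (λ p^α≡8 → M₈-Γ pr (p^[3+t]≡8⇒p≡2∧t≡0 t pr p^α≡8))
  , (λ p^α≢8 → GeneralCase.Γ-iso p^α≢8) )
  where open ModularGroup p t pr
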